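{- Let $G=(V,E)$ be a finite simple undirected graph with totally ordered vertex set $V$, and let $\mathrm{ref}(S)=\{\rho:(u,\rho)\in S\}$. Let $\rho,\sigma\in\mathrm{ref}(S)$ with $\rho\neq\sigma$. Then applying Rule 1 to $\rho$, i.e. deleting all vertices of $N_2(\rho)\cup N_3(\rho)$ (and adding $\rho$ to the dominating set), leaves the type-3 neighbourhood $N_3(\sigma)$ of $\sigma$ unaffected: no vertex of $N_3(\sigma)$ lies in $N_2(\rho)\cup N_3(\rho)$.
   Context: For $u\in V$, $N(u)$ is the open neighbourhood, $N[u]=N(u)\cup\{u\}$, $\deg(u)=|N(u)|$. For $\rho\in V$: $N_1(\rho)=\{u\in N(\rho): N(u)\setminus N[\rho]\neq\emptyset\}$; $N_2(\rho)=\{u\in N(\rho)\setminus N_1(\rho): N(u)\cap N_1(\rho)\neq\emptyset\}$; $N_3(\rho)=N(\rho)\setminus N_1(\rho)\setminus N_2(\rho)$ (all computed in $G$). Rule 1 (Alber, Fellows, Niedermeier): if $N_3(\rho)\neq\emptyset$, add $\rho$ to the dominating set and delete $N_2(\rho)\cup N_3(\rho)$. Let $C=\{(u,\rho): \rho\in V,\ u\in N_3(\rho)\}$, $\mathrm{canRef}(u)=\arg\max_{v\in N[u]}(\deg(v),v)$ in lexicographic order (largest degree, ties broken by largest vertex), and $S=\{(u,\rho)\in C:\ \rho=\mathrm{canRef}(u)\}$. -}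

module Defs where

open import Data.Nat using (ℕ; _+_; _<_)
open import Data.Fin using (Fin) renaming (_≤_ to _≤ᶠ_)
open import Data.Bool using (Bool; true; false; if_then_else_)
open import Data.List using (List; map; allFin)
open import Data.Nat.ListAction using (sum)
open import Data.Product using (Σ; _×_; ∃)
open import Data.Sum using (_⊎_)
open import Relation.Nullary using (¬_)
open import Relation.Binary.PropositionalEquality using (_≡_; _≢_)

record Graph (n : ℕ) : Set where
  field
    E     : Fin n → Fin n → Bool
    sym   : ∀ u v → E u v ≡ E v u
    irref : ∀ u → E u u ≡ false

module _ {n : ℕ} (G : Graph n) where
  open Graph G

  Adj : Fin n → Fin n → Set
  Adj u v = E u v ≡ true

  InClosedNbhd : Fin n → Fin n → Set
  InClosedNbhd u v = v ≡ u ⊎ Adj u v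

  deg : Fin n → ℕ
  deg u = sum (map (λ v → if E u v then 1 else 0) (allFin n))

  N₁ : Fin n → Fin n → Set
  N₁ ρ u = Adj ρ u × ∃ λ w → Adj u w × ¬ InClosedNbhd ρ w

  N₂ : Fin n → Fin n → Set
  N₂ ρ u = Adj ρ u × ¬ N₁ ρ u × ∃ λ w → Adj u w × N₁ ρ w

  N₃ : Fin n → Fin n → Set
  N₃ ρ u = Adj ρ u × ¬ N₁ ρ u × ¬ N₂ ρ u

  -- ρ = canRef(u) = argmax_{v ∈ N[u]} (deg v, v) in lexicographic order
  IsCanRef : Fin n → Fin n → Set
  IsCanRef u ρ =
    InClosedNbhd u ρ ×
    (∀ v → InClosedNbhd u v → (deg v < deg ρ) ⊎ (deg v ≡ deg ρ × v ≤ᶠ ρ))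

  -- (u, ρ) ∈ S  (so in particular (u, ρ) ∈ C)
  InS : Fin n → Fin n → Set
  InS u ρ = N₃ ρ u × IsCanRef u ρ

  InRef : Fin n → Set
  InRef ρ = ∃ λ u → InS u ρ

{-# OPTIONS --safe #-}
module Submission where

-- Since x ∈ N₃(σ), every neighbour y of x has N[y] ⊆ N[σ]; in particular N[ρ] ⊆ N[σ].
-- Then σ lies in the closed neighbourhood of any u with canRef(u) = ρ (as u ∈ N[ρ]), so
-- (deg σ, σ) ≤ (deg ρ, ρ). If x ∈ N₃(ρ), the same argument with ρ and σ swapped gives the
-- reverse inequality, forcing ρ = σ. If x ∈ N₂(ρ), some neighbour y ∈ N₁(ρ) of x has a
-- neighbour z ∉ N[ρ], yet z ∈ N[y] ⊆ N[σ]; so N[ρ] ⊊ N[σ] and deg ρ < deg σ, contradicting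
-- (deg σ, σ) ≤ (deg ρ, ρ).

open import Defs
open import Data.Bool using (Bool; true; false; if_then_else_) renaming (_≟_ to _≟ᵇ_)
open import Data.Empty using (⊥-elim)
open import Data.Fin using (Fin; zero; suc) renaming (_≤_ to _≤ᶠ_)
open import Data.Fin.Properties using (_≟_; ≤-antisym)
open import Data.List using (tabulate)
open import Data.List.Properties using (map-tabulate)
open import Data.Nat using (ℕ; zero; suc; _+_; _≤_; _<_; z≤n; s≤s)
open import Data.Nat.Properties
  using (+-0-commutativeMonoid; ≤-refl; ≤-reflexive; <⇒≤; <⇒≱; <-irrefl; <-asym;
         +-mono-≤; +-mono-<-≤; +-mono-≤-<; +-cancelʳ-<; module ≤-Reasoning)
open import Algebra.Properties.CommutativeMonoid.Sum +-0-commutativeMonoid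
  using (sum; sum-syntax; sum-cong-≗; ∑-distrib-+; sum-replicate-zero)
import Data.Nat.ListAction as List
open import Data.Product using (_,_; proj₁; proj₂)
open import Data.Product.Relation.Binary.Lex.Strict using (×-Lex; ×-antisymmetric)
open import Data.Sum using (_⊎_; inj₁; inj₂; [_,_])
open import Function using (id; _∘_; _∘₂_; _on_)
open import Relation.Binary.PropositionalEquality
  using (_≡_; _≢_; refl; sym; trans; cong; cong₂; module ≡-Reasoning)
open import Relation.Nullary using (¬_; Dec; yes; no; does)
open import Relation.Nullary.Decidable using (_⊎-dec_; dec-true; dec-false; decidable-stable)

indicator : Bool → ℕ
indicator b = if b then 1 else 0

indicator-mono : {P Q : Set} → (P → Q) → (p? : Dec P) (q? : Dec Q) →
                 indicator (does p?) ≤ indicator (does q?)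
indicator-mono P⇒Q (no _)  _       = z≤n
indicator-mono P⇒Q (yes _) (yes _) = ≤-refl
indicator-mono P⇒Q (yes p) (no ¬q) = ⊥-elim (¬q (P⇒Q p))

indicator-< : {P Q : Set} → ¬ P → Q → (p? : Dec P) (q? : Dec Q) →
              indicator (does p?) < indicator (does q?)
indicator-< ¬p q p? q? rewrite dec-false p? ¬p | dec-true q? q = s≤s z≤n

sum-tabulate : ∀ {n} (f : Fin n → ℕ) → List.sum (tabulate f) ≡ sum f
sum-tabulate {zero}  f = refl
sum-tabulate {suc n} f = cong (f zero +_) (sum-tabulate (f ∘ suc))

sum-mono-≤ : ∀ {n} {f g : Fin n → ℕ} → (∀ i → f i ≤ g i) → sum f ≤ sum g
sum-mono-≤ {zero}  f≤g = z≤n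
sum-mono-≤ {suc n} f≤g = +-mono-≤ (f≤g zero) (sum-mono-≤ (f≤g ∘ suc))

sum-mono-< : ∀ {n} {f g : Fin n → ℕ} → (∀ i → f i ≤ g i) → ∀ i → f i < g i → sum f < sum g
sum-mono-< f≤g zero    f<g = +-mono-<-≤ f<g (sum-mono-≤ (f≤g ∘ suc))
sum-mono-< f≤g (suc i) f<g = +-mono-≤-< (f≤g zero) (sum-mono-< (f≤g ∘ suc) i f<g)

∑-indicator-≟ : ∀ {n} (j : Fin n) → ∑[ i < n ] indicator (does (i ≟ j)) ≡ 1
∑-indicator-≟ {suc n} zero    = cong suc (sum-replicate-zero n)
∑-indicator-≟ {suc n} (suc j) = ∑-indicator-≟ j

module Neighbourhoods {n : ℕ} (G : Graph n) where
  open Graph G using (E; irref) renaming (sym to E-sym)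

  Adj-sym : ∀ {u v} → Adj G u v → Adj G v u
  Adj-sym {u} {v} u~v = trans (E-sym v u) u~v

  InClosedNbhd-sym : ∀ {u v} → InClosedNbhd G u v → InClosedNbhd G v u
  InClosedNbhd-sym (inj₁ v≡u) = inj₁ (sym v≡u)
  InClosedNbhd-sym (inj₂ u~v) = inj₂ (Adj-sym u~v)

  Adj? : ∀ u v → Dec (Adj G u v)
  Adj? u v = E u v ≟ᵇ true

  InClosedNbhd? : ∀ u v → Dec (InClosedNbhd G u v)
  InClosedNbhd? u v = v ≟ u ⊎-dec Adj? u v

  N[_]⊆N[_] : Fin n → Fin n → Set
  N[ u ]⊆N[ v ] = ∀ {w} → InClosedNbhd G u w → InClosedNbhd G v w

  deg≡∑ : ∀ u → deg G u ≡ ∑[ v < n ] indicator (E u v)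
  deg≡∑ u = trans (cong List.sum (map-tabulate (λ v → v) (indicator ∘ E u)))
                  (sum-tabulate (indicator ∘ E u))

  indicator-InClosedNbhd : ∀ u v →
    indicator (does (InClosedNbhd? u v)) ≡ indicator (E u v) + indicator (does (v ≟ u))
  indicator-InClosedNbhd u v with v ≟ u
  ... | yes refl rewrite irref u = refl
  ... | no _ with E u v
  ...   | true  = refl
  ...   | false = refl

  ∑-InClosedNbhd : ∀ u → ∑[ v < n ] indicator (does (InClosedNbhd? u v)) ≡ deg G u + 1
  ∑-InClosedNbhd u = begin
    ∑[ v < n ] indicator (does (InClosedNbhd? u v))
      ≡⟨ sum-cong-≗ (indicator-InClosedNbhd u) ⟩
    ∑[ v < n ] (indicator (E u v) + indicator (does (v ≟ u)))
      ≡⟨ ∑-distrib-+ (indicator ∘ E u) (λ v → indicator (does (v ≟ u))) ⟩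
    ∑[ v < n ] indicator (E u v) + ∑[ v < n ] indicator (does (v ≟ u))
      ≡⟨ cong₂ _+_ (sym (deg≡∑ u)) (∑-indicator-≟ u) ⟩
    deg G u + 1
      ∎
    where open ≡-Reasoning

  closedNbhd⊂⇒deg< : ∀ {ρ σ z} → N[ ρ ]⊆N[ σ ] → InClosedNbhd G σ z → ¬ InClosedNbhd G ρ z →
               deg G ρ < deg G σ
  closedNbhd⊂⇒deg< {ρ} {σ} {z} ρ⊆σ z∈N[σ] z∉N[ρ] =
    +-cancelʳ-< 1 (deg G ρ) (deg G σ) (begin-strict
      deg G ρ + 1                                     ≡⟨ ∑-InClosedNbhd ρ ⟨
      ∑[ v < n ] indicator (does (InClosedNbhd? ρ v)) <⟨ sum-mono-< pointwise z at-z ⟩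
      ∑[ v < n ] indicator (does (InClosedNbhd? σ v)) ≡⟨ ∑-InClosedNbhd σ ⟩
      deg G σ + 1                                     ∎)
    where
    open ≤-Reasoning
    pointwise : ∀ v →
                indicator (does (InClosedNbhd? ρ v)) ≤ indicator (does (InClosedNbhd? σ v))
    pointwise v = indicator-mono ρ⊆σ (InClosedNbhd? ρ v) (InClosedNbhd? σ v)
    at-z : indicator (does (InClosedNbhd? ρ z)) < indicator (does (InClosedNbhd? σ z))
    at-z = indicator-< z∉N[ρ] z∈N[σ] (InClosedNbhd? ρ z) (InClosedNbhd? σ z)

  ¬N₁⇒closedNbhd⊆ : ∀ {x σ} → Adj G σ x → ¬ N₁ G σ x → N[ x ]⊆N[ σ ]
  ¬N₁⇒closedNbhd⊆ σ~x x∉N₁ (inj₁ refl) = inj₂ σ~x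
  ¬N₁⇒closedNbhd⊆ {σ = σ} σ~x x∉N₁ {w} (inj₂ x~w) =
    decidable-stable (InClosedNbhd? σ w) (λ w∉N[σ] → x∉N₁ (σ~x , w , x~w , w∉N[σ]))

  N₃-neighbour⇒closedNbhd⊆ : ∀ {σ x y} → N₃ G σ x → Adj G x y → N[ y ]⊆N[ σ ]
  N₃-neighbour⇒closedNbhd⊆ (σ~x , x∉N₁ , x∉N₂) x~y
    with ¬N₁⇒closedNbhd⊆ σ~x x∉N₁ (inj₂ x~y)
  ... | inj₁ refl = id
  ... | inj₂ σ~y  = ¬N₁⇒closedNbhd⊆ σ~y (λ y∈N₁ → x∉N₂ (σ~x , x∉N₁ , _ , x~y , y∈N₁))

  _≤deg_ : Fin n → Fin n → Set
  _≤deg_ = ×-Lex _≡_ _<_ _≤ᶠ_ on λ v → deg G v , v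

  ≤deg-antisym : ∀ {u v} → u ≤deg v → v ≤deg u → u ≡ v
  ≤deg-antisym {u} {v} = proj₂ ∘₂ ×-antisymmetric {_≈₁_ = _≡_} {_<₁_ = _<_} {_≈₂_ = _≡_}
    sym <-irrefl <-asym ≤-antisym {deg G u , u} {deg G v , v}

  ≤deg⇒deg≤ : ∀ {u v} → u ≤deg v → deg G u ≤ deg G v
  ≤deg⇒deg≤ = [ <⇒≤ , ≤-reflexive ∘ proj₁ ]

  ref-maximal : ∀ {ρ σ} → InRef G ρ → N[ ρ ]⊆N[ σ ] → σ ≤deg ρ
  ref-maximal {σ = σ} (u , (ρ~u , _) , (_ , ρ-max)) ρ⊆σ =
    ρ-max σ (InClosedNbhd-sym (ρ⊆σ (inj₂ ρ~u)))

mainTheorem3 : (n : ℕ) (G : Graph n) (ρ σ : Fin n) →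
    InRef G ρ → InRef G σ → ρ ≢ σ →
    ∀ x → N₃ G σ x → ¬ (N₂ G ρ x ⊎ N₃ G ρ x)
mainTheorem3 n G ρ σ ρ∈ref σ∈ref ρ≢σ x x∈N₃σ = [ x∉N₂ρ , x∉N₃ρ ]
  where
  open Neighbourhoods G

  N[ρ]⊆N[σ] : Adj G ρ x → N[ ρ ]⊆N[ σ ]
  N[ρ]⊆N[σ] = N₃-neighbour⇒closedNbhd⊆ x∈N₃σ ∘ Adj-sym

  σ≤ρ : Adj G ρ x → σ ≤deg ρ
  σ≤ρ ρ~x = ref-maximal ρ∈ref (N[ρ]⊆N[σ] ρ~x)

  x∉N₂ρ : ¬ N₂ G ρ x
  x∉N₂ρ (ρ~x , _ , y , x~y , _ , z , y~z , z∉N[ρ]) =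
    <⇒≱ (closedNbhd⊂⇒deg< (N[ρ]⊆N[σ] ρ~x) z∈N[σ] z∉N[ρ]) (≤deg⇒deg≤ (σ≤ρ ρ~x))
    where
    z∈N[σ] : InClosedNbhd G σ z
    z∈N[σ] = N₃-neighbour⇒closedNbhd⊆ x∈N₃σ x~y (inj₂ y~z)

  x∉N₃ρ : ¬ N₃ G ρ x
  x∉N₃ρ x∈N₃ρ@(ρ~x , _) = ρ≢σ (≤deg-antisym ρ≤σ (σ≤ρ ρ~x))
    where
    ρ≤σ : ρ ≤deg σ
    ρ≤σ = ref-maximal σ∈ref (N₃-neighbour⇒closedNbhd⊆ x∈N₃ρ (Adj-sym (proj₁ x∈N₃σ)))
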